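{- Let $(W,S)$ be a Coxeter system of finite rank $k:=|S|$ with a weak Lehmer code $L^W$, and let $L\in L^W$. Then the Bruhat order on the set $U(L)$ of $L$-unimodal elements is isomorphic to the componentwise order on $\{L(w):w \in U(L)\}$.
   Context: A finite set $L^W=\{L_1,\ldots,L_h\}$ is a weak Lehmer code for $(W,S)$ if: (1) each $L_i: W\to \mathbb{N}^k$ is a rank-preserving injective function (rank of $x\in\mathbb{N}^k$ is the sum of its entries, rank in $W$ is the length $\ell$); (2) for every $w\in W$ and $i\in[h]$, if $\max\{L_i(v): v\leq w\}$ has exactly one element then $\{L_i(v): v\leq w\}$ is an order ideal of $\mathbb{N}^k$ (componentwise order), i.e. a multicomplex; (3) for every $w\in W$ there exist $i\in[h]$ and a Bruhat order automorphism $\phi$ of $W$ such that $\{(L_i\circ\phi)(v): v\leq w\}$ is a multicomplex. Here $\leq$ on $W$ is the Bruhat order. For $L\in L^W$, an element $w\in W$ is $L$-principal if $|\max\{L(v):v\leq w\}|=1$; $\Pr(L)$ denotes the set of $L$-principal elements. For $w\in W$ let $h_w:=\sum_{v\leq w}q^{\ell(v)}$, and for $w\in\Pr(L)$ let $O_w:=\{v\in \Pr(L): h_v=h_w\}$. An element $w\in\Pr(L)$ is $L$-unimodal if $L(w)$ is the minimum in lexicographic order of $\{L(v):v\in O_w\}$; $U(L)$ is the set of $L$-unimodal elements. -}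

module Defs where

open import Data.Nat using (ℕ; zero; suc; _≤_; _<_)
open import Data.Fin using (Fin)
open import Data.List using (List; []; _∷_; _++_; reverse; length)
open import Data.List.Relation.Unary.All using (All)
open import Data.List.Relation.Unary.Any using (Any)
open import Data.List.Relation.Unary.AllPairs using (AllPairs)
open import Data.Vec using (Vec; sum)
open import Data.Vec.Relation.Binary.Pointwise.Inductive using (Pointwise)
open import Data.Vec.Relation.Binary.Lex.NonStrict using (Lex-≤)
open import Data.Product using (Σ; ∃; ∃₂; _×_; _,_)
open import Data.Sum using (_⊎_)
open import Relation.Binary.PropositionalEquality using (_≡_; _≢_)
open import Relation.Binary.Construct.Closure.Equivalence using (EqClosure)
open import Relation.Binary.Construct.Closure.ReflexiveTransitive using (Star)
open import Relation.Nullary using (¬_)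
open import Function.Bundles using (_⇔_)
open import Function.Base using (_∘_)

-- Coxeter systems (W,S) of finite rank k = |S|, S = {s_0,...,s_{k-1}},
-- given by a Coxeter matrix.  The entry 0 encodes m(s,t) = ∞.

record CoxeterMatrix (k : ℕ) : Set where
  field
    m       : Fin k → Fin k → ℕ
    diag    : ∀ i → m i i ≡ 1
    symm    : ∀ i j → m i j ≡ m j i
    offdiag : ∀ i j → i ≢ j → (m i j ≡ 0) ⊎ (2 ≤ m i j)

Word : ℕ → Set
Word k = List (Fin k)

alt : ∀ {k} → Fin k → Fin k → ℕ → Word k
alt s t zero    = []
alt s t (suc n) = s ∷ alt t s n

module Coxeter {k : ℕ} (M : CoxeterMatrix k) where

  open CoxeterMatrix M

  data Relator : Word k → Word k → Set where
    invol : ∀ s → Relator (s ∷ s ∷ []) []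
    braid : ∀ s t → m s t ≢ 0 → Relator (alt s t (m s t)) (alt t s (m s t))

  Step₁ : Word k → Word k → Set
  Step₁ u w = ∃₂ λ a b → ∃₂ λ l r →
                Relator l r × (u ≡ a ++ l ++ b) × (w ≡ a ++ r ++ b)

  -- equality in W: u and w represent the same group element.
  -- W is the set of words modulo _∼_ (a setoid).
  _∼_ : Word k → Word k → Set
  _∼_ = EqClosure Step₁

  IsLength : Word k → ℕ → Set
  IsLength w n = (∃ λ v → (v ∼ w) × (length v ≡ n))
               × (∀ v → v ∼ w → n ≤ length v)

  -- reflections: conjugates x s x⁻¹ of simple reflections (x⁻¹ = reverse x)
  Reflection : Word k → Set
  Reflection t = ∃₂ λ x s → t ≡ x ++ s ∷ reverse x

  BStep : Word k → Word k → Set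
  BStep u w = ∃ λ t → Reflection t × (w ∼ (u ++ t))
              × ∃₂ λ a b → IsLength u a × IsLength w b × a < b

  _≤B_ : Word k → Word k → Set
  u ≤B w = ∃ λ v → (u ∼ v) × Star BStep v w

  _≤ᶜ_ : Vec ℕ k → Vec ℕ k → Set
  _≤ᶜ_ = Pointwise _≤_

  _≤lex_ : Vec ℕ k → Vec ℕ k → Set
  _≤lex_ = Lex-≤ _≡_ _≤_

  IsMax : (Vec ℕ k → Set) → Vec ℕ k → Set
  IsMax P x = P x × (∀ y → P y → x ≤ᶜ y → y ≡ x)

  UniqueMax : (Vec ℕ k → Set) → Set
  UniqueMax P = ∃ λ x → IsMax P x × (∀ y → IsMax P y → y ≡ x)

  Multicomplex : (Vec ℕ k → Set) → Set
  Multicomplex P = ∀ x y → P x → y ≤ᶜ x → P y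

  LowerImage : (Word k → Vec ℕ k) → Word k → Vec ℕ k → Set
  LowerImage L w x = ∃ λ v → (v ≤B w) × (L v ≡ x)

  WellDefined : (Word k → Vec ℕ k) → Set
  WellDefined L = ∀ u v → u ∼ v → L u ≡ L v

  InjectiveW : (Word k → Vec ℕ k) → Set
  InjectiveW L = ∀ u v → L u ≡ L v → u ∼ v

  RankPreserving : (Word k → Vec ℕ k) → Set
  RankPreserving L = ∀ w → IsLength w (sum (L w))

  record BruhatAutomorphism (φ : Word k → Word k) : Set where
    field
      wellDefined : ∀ u v → u ∼ v → φ u ∼ φ v
      injective   : ∀ u v → φ u ∼ φ v → u ∼ v
      surjective  : ∀ w → ∃ λ v → φ v ∼ w
      monotone    : ∀ u v → (u ≤B v) ⇔ (φ u ≤B φ v)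

  record WeakLehmerCode (h : ℕ) (Ls : Fin h → Word k → Vec ℕ k) : Set where
    field
      wellDefined    : ∀ i → WellDefined (Ls i)
      injective      : ∀ i → InjectiveW (Ls i)
      rankPreserving : ∀ i → RankPreserving (Ls i)
      principalIdeal : ∀ i w → UniqueMax (LowerImage (Ls i) w)
                             → Multicomplex (LowerImage (Ls i) w)
      someIdeal      : ∀ w → ∃ λ i → ∃ λ φ → BruhatAutomorphism φ
                             × Multicomplex (LowerImage (Ls i ∘ φ) w)

  -- h_w = Σ_{v ≤ w} q^{ℓ(v)}, described through its coefficients.

  HasCount : (Word k → Set) → ℕ → Set
  HasCount P c = ∃ λ xs → (length xs ≡ c) × All P xs
                 × AllPairs (λ a b → ¬ (a ∼ b)) xs
                 × (∀ u → P u → Any (u ∼_) xs)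

  HCoeff : Word k → ℕ → ℕ → Set
  HCoeff w n c = HasCount (λ u → (u ≤B w) × IsLength u n) c

  SameH : Word k → Word k → Set
  SameH v w = ∀ n c → HCoeff v n c ⇔ HCoeff w n c

  Principal : (Word k → Vec ℕ k) → Word k → Set
  Principal L w = UniqueMax (LowerImage L w)

  Unimodal : (Word k → Vec ℕ k) → Word k → Set
  Unimodal L w = Principal L w
               × (∀ v → Principal L v → SameH v w → L w ≤lex L v)

  UImage : (Word k → Vec ℕ k) → Vec ℕ k → Set
  UImage L x = ∃ λ w → Unimodal L w × (L w ≡ x)

  record UIsoVia (L : Word k → Vec ℕ k) (f : Word k → Vec ℕ k) : Set where
    field
      wellDefined : ∀ u v → u ∼ v → f u ≡ f v
      intoImage   : ∀ u → Unimodal L u → UImage L (f u)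
      onto        : ∀ x → UImage L x → ∃ λ u → Unimodal L u × (f u ≡ x)
      injective   : ∀ u v → Unimodal L u → Unimodal L v → f u ≡ f v → u ∼ v
      orderIso    : ∀ u v → Unimodal L u → Unimodal L v
                    → (u ≤B v) ⇔ (f u ≤ᶜ f v)

{-# OPTIONS --safe #-}
-- The rank (coordinate sum) is strictly monotone on (ℕ^k, ≤ᶜ), so a subset of bounded
-- rank has no infinite ascending chains: every element lies below a maximal one (up to
-- double negation, harmless because ≤ᶜ is decidable), and a unique maximal element is
-- therefore a greatest element. For principal w, L w has the largest possible rank ℓ(w)
-- in {L v : v ≤ w}, so it is that greatest element, and u ≤ w ⇒ L u ≤ᶜ L w. Conversely
-- the order ideal property puts L u into {L v : v ≤ w}, and injectivity of L turns this
-- into u ≤ w. Only the principality of the upper element is ever used.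
module Submission where

open import Defs
open import Data.Nat using (ℕ)
open import Data.Fin using (Fin)
open import Data.Vec using (Vec)
open import Data.Product using (∃)

open import Data.Nat using (suc; zero; _+_; _≤_; _<_; _≟_; _≤?_)
open import Data.Nat.Properties
  using (module ≤-Reasoning; ≤-refl; ≤-trans; ≤-reflexive; ≤-antisym; <⇒≤; <⇒≱; ≤∧≢⇒<;
         +-suc; +-mono-≤; +-monoʳ-≤; +-monoʳ-<; +-mono-<-≤; m≤m+n)
open import Data.Vec using (_∷_; sum)
open import Data.Vec.Properties using (≡-dec)
open import Data.Vec.Relation.Binary.Pointwise.Inductive as Pointwise
  using (Pointwise; []; _∷_)
open import Data.Product using (_×_; _,_)
open import Data.Empty using (⊥-elim)
open import Relation.Nullary using (¬_; yes; no)
open import Relation.Nullary.Decidable using (decidable-stable)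
open import Relation.Binary.PropositionalEquality using (_≡_; _≢_; refl; sym; cong; subst)
open import Relation.Binary.Construct.Closure.Equivalence as EqClosure using ()
open import Relation.Binary.Construct.Closure.ReflexiveTransitive using (Star; ε; _◅_)
open import Function.Base using (_∘_)
open import Function.Bundles using (_⇔_; mk⇔)

sum-mono-≤ : ∀ {n} {x y : Vec ℕ n} → Pointwise _≤_ x y → sum x ≤ sum y
sum-mono-≤ []       = ≤-refl
sum-mono-≤ (p ∷ ps) = +-mono-≤ p (sum-mono-≤ ps)

sum-mono-< : ∀ {n} {x y : Vec ℕ n} → Pointwise _≤_ x y → x ≢ y → sum x < sum y
sum-mono-< []                                x≢y = ⊥-elim (x≢y refl)
sum-mono-< {x = a ∷ _} {b ∷ _} (a≤b ∷ ps) x≢y with a ≟ b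
... | yes refl = +-monoʳ-< a (sum-mono-< ps (x≢y ∘ cong (a ∷_)))
... | no a≢b   = +-mono-<-≤ (≤∧≢⇒< a≤b a≢b) (sum-mono-≤ ps)

Pointwise-≤∧sum-≥⇒≡ : ∀ {n} {x y : Vec ℕ n} → Pointwise _≤_ x y → sum y ≤ sum x → y ≡ x
Pointwise-≤∧sum-≥⇒≡ {x = x} {y} x≤y Σy≤Σx =
  decidable-stable (≡-dec _≟_ y x) λ y≢x → <⇒≱ (sum-mono-< x≤y (y≢x ∘ sym)) Σy≤Σx

module _ {k : ℕ} (M : CoxeterMatrix k) where
  open Coxeter M

  ≤ᶜ-refl : ∀ {x} → x ≤ᶜ x
  ≤ᶜ-refl = Pointwise.refl ≤-refl

  ≤ᶜ-trans : ∀ {x y z} → x ≤ᶜ y → y ≤ᶜ z → x ≤ᶜ z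
  ≤ᶜ-trans = Pointwise.trans ≤-trans

  module RankBounded (P : Vec ℕ k → Set) (B : ℕ) (bounded : ∀ x → P x → sum x ≤ B) where

    -- n is fuel bounding the rank gap B − sum y, which shrinks each time we climb in P.
    ¬¬maximal-above : ∀ n {y} → P y → B ≤ n + sum y → ¬ ¬ ∃ λ x → IsMax P x × y ≤ᶜ x
    ¬¬maximal-above n {y} Py B≤n+Σy noMax = noMax (y , (Py , y-maximal n B≤n+Σy) , ≤ᶜ-refl)
      where
      y-maximal : ∀ n → B ≤ n + sum y → ∀ z → P z → y ≤ᶜ z → z ≡ y
      y-maximal zero    B≤Σy    z Pz y≤z =
        Pointwise-≤∧sum-≥⇒≡ y≤z (≤-trans (bounded z Pz) B≤Σy)
      y-maximal (suc n) B≤1+n+Σy z Pz y≤z =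
        decidable-stable (≡-dec _≟_ z y) λ z≢y →
          ¬¬maximal-above n Pz (B≤n+Σz z≢y) λ (x , xMax , z≤x) →
            noMax (x , xMax , ≤ᶜ-trans y≤z z≤x)
        where
        B≤n+Σz : z ≢ y → B ≤ n + sum z
        B≤n+Σz z≢y = begin
          B                ≤⟨ B≤1+n+Σy ⟩
          suc (n + sum y)  ≡⟨ +-suc n (sum y) ⟨
          n + suc (sum y)  ≤⟨ +-monoʳ-≤ n (sum-mono-< y≤z (z≢y ∘ sym)) ⟩
          n + sum z        ∎
          where open ≤-Reasoning

    uniqueMax-greatest : ((x , _) : UniqueMax P) → ∀ y → P y → y ≤ᶜ x
    uniqueMax-greatest (x , _ , unique) y Py =
      decidable-stable (Pointwise.decidable _≤?_ y x) λ y≰x →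
        ¬¬maximal-above B Py (m≤m+n B (sum y)) λ (x′ , x′Max , y≤x′) →
          y≰x (subst (y ≤ᶜ_) (unique x′ x′Max) y≤x′)

  ∼-sym : ∀ {u v} → u ∼ v → v ∼ u
  ∼-sym = EqClosure.symmetric Step₁

  ∼-trans : ∀ {u v w} → u ∼ v → v ∼ w → u ∼ w
  ∼-trans = EqClosure.transitive Step₁

  IsLength-resp-∼ : ∀ {u v n} → u ∼ v → IsLength u n → IsLength v n
  IsLength-resp-∼ u∼v ((r , r∼u , |r|≡n) , minimal) =
    (r , ∼-trans r∼u u∼v , |r|≡n) , λ s s∼v → minimal s (∼-trans s∼v (∼-sym u∼v))

  IsLength-unique : ∀ {w a b} → IsLength w a → IsLength w b → a ≡ b
  IsLength-unique ((r , r∼w , refl) , minimalᵃ) ((s , s∼w , refl) , minimalᵇ) =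
    ≤-antisym (minimalᵃ s s∼w) (minimalᵇ r r∼w)

  Star-BStep⇒length-≤ : ∀ {v w a b} → Star BStep v w → IsLength v a → IsLength w b → a ≤ b
  Star-BStep⇒length-≤ ε ℓv ℓw = ≤-reflexive (IsLength-unique ℓv ℓw)
  Star-BStep⇒length-≤ ((_ , _ , _ , _ , _ , ℓv , ℓv′ , a′<b′) ◅ steps) ℓv″ ℓw =
    ≤-trans (≤-reflexive (IsLength-unique ℓv″ ℓv))
            (≤-trans (<⇒≤ a′<b′) (Star-BStep⇒length-≤ steps ℓv′ ℓw))

  ≤B⇒length-≤ : ∀ {v w a b} → v ≤B w → IsLength v a → IsLength w b → a ≤ b
  ≤B⇒length-≤ (_ , v∼v′ , steps) ℓv = Star-BStep⇒length-≤ steps (IsLength-resp-∼ v∼v′ ℓv)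

  ≤B-refl : ∀ {w} → w ≤B w
  ≤B-refl = _ , ε , ε

  ≤B-respˡ-∼ : ∀ {u u′ w} → u ∼ u′ → u ≤B w → u′ ≤B w
  ≤B-respˡ-∼ u∼u′ (v , u∼v , steps) = v , ∼-trans (∼-sym u∼u′) u∼v , steps

  module _ {L : Word k → Vec ℕ k} (rank : RankPreserving L) where

    LowerImage-sum-≤ : ∀ w x → LowerImage L w x → sum x ≤ sum (L w)
    LowerImage-sum-≤ w _ (v , v≤w , refl) = ≤B⇒length-≤ v≤w (rank v) (rank w)

    principal-greatest : ∀ {w} → Principal L w → ∀ x → LowerImage L w x → x ≤ᶜ L w
    principal-greatest {w} uniqueMax@(m , (m∈ , _) , _) x x∈ =
      subst (x ≤ᶜ_) m≡Lw (greatest x x∈)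
      where
      open RankBounded (LowerImage L w) (sum (L w)) (LowerImage-sum-≤ w)
      greatest : ∀ x → LowerImage L w x → x ≤ᶜ m
      greatest = uniqueMax-greatest uniqueMax
      m≡Lw : m ≡ L w
      m≡Lw = Pointwise-≤∧sum-≥⇒≡ (greatest (L w) (w , ≤B-refl , refl)) (LowerImage-sum-≤ w m m∈)

  module _ {h Ls} (code : WeakLehmerCode h Ls) (i : Fin h) where
    open WeakLehmerCode code

    principal-≤B⇔≤ᶜ : ∀ {u v} → Principal (Ls i) v → (u ≤B v) ⇔ (Ls i u ≤ᶜ Ls i v)
    principal-≤B⇔≤ᶜ {u} {v} principal = mk⇔ to from
      where
      to : u ≤B v → Ls i u ≤ᶜ Ls i v
      to u≤v = principal-greatest (rankPreserving i) principal (Ls i u) (u , u≤v , refl)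
      from : Ls i u ≤ᶜ Ls i v → u ≤B v
      from Lu≤Lv with principalIdeal i v principal (Ls i v) (Ls i u) (v , ≤B-refl , refl) Lu≤Lv
      ... | u′ , u′≤v , Lu′≡Lu = ≤B-respˡ-∼ (injective i u′ u Lu′≡Lu) u′≤v

mainTheorem4 : (k : ℕ) (M : CoxeterMatrix k) (h : ℕ) (Ls : Fin h → Word k → Vec ℕ k)
    → Coxeter.WeakLehmerCode M h Ls
    → (i : Fin h)
    → ∃ λ f → Coxeter.UIsoVia M (Ls i) f
mainTheorem4 k M h Ls code i = Ls i , record
  { wellDefined = wellDefined i
  ; intoImage   = λ u unimodal → u , unimodal , refl
  ; onto        = λ _ x∈UImage → x∈UImage
  ; injective   = λ u v _ _ → injective i u v
  ; orderIso    = λ _ _ _ (principal , _) → principal-≤B⇔≤ᶜ M code i principal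
  }
  where open Coxeter.WeakLehmerCode code
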